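{- Let $\Gamma$ be a simple strongly connected digraph with vertex set $X$ and diameter $D$. Then $\Gamma$ is a distance-regular digraph if and only if there exist numbers $b_{ij}$ $(0\le i,j\le D)$ such that $|\Gamma^{\rightarrow}_1(y)\cap\Gamma^{\rightarrow}_j(x)|=b_{ij}$ for all $x\in X$ and all $y\in\Gamma^{\rightarrow}_i(x)$ $(0\le i,j\le D)$.
   Context: $\partial(x,y)$ is the directed distance; $\Gamma^{\rightarrow}_i(x)=\{z\mid\partial(x,z)=i\}$; $\Gamma^{\rightarrow}_1(y)$, $\Gamma^{\leftarrow}_1(y)$ are the out- and in-neighbourhoods of $y$. $\Gamma$ is a distance-regular digraph if there are integers $d^{\rightarrow}_{ij},d^{\leftarrow}_{ij}$ $(0\le i,j\le D)$ such that for every $x\in X$ and every $y\in\Gamma^{\rightarrow}_i(x)$: $|\Gamma^{\rightarrow}_1(y)\cap\Gamma^{\rightarrow}_j(x)|=d^{\rightarrow}_{ij}$ and $|\Gamma^{\leftarrow}_1(y)\cap\Gamma^{\rightarrow}_j(x)|=d^{\leftarrow}_{ij}$. -}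

module Defs where

open import Data.Nat using (ℕ; zero; suc; _+_; _≤_)
open import Data.Fin using (Fin; zero; suc)
open import Data.Bool using (Bool; true; false; _∧_; _∨_; not; if_then_else_)
open import Data.Fin.Properties using (_≟_)
open import Relation.Nullary.Decidable using (⌊_⌋)
open import Data.Product using (Σ; _×_; ∃; ∃-syntax)
open import Relation.Binary.PropositionalEquality using (_≡_)

-- A digraph on the finite vertex set X = Fin n, given by its (decidable)
-- arc relation: adj x y ≡ true iff there is an arc x → y.
-- (Simple digraph: at most one arc x → y per ordered pair, which the
-- Boolean relation gives automatically, and no loops.)
Digraph : ℕ → Set
Digraph n = Fin n → Fin n → Bool

Simple : ∀ {n} → Digraph n → Set
Simple {n} A = (x : Fin n) → A x x ≡ false

anyFin : ∀ {n} → (Fin n → Bool) → Bool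
anyFin {zero} f = false
anyFin {suc n} f = f zero ∨ anyFin (λ i → f (suc i))

countFin : ∀ {n} → (Fin n → Bool) → ℕ
countFin {zero} f = 0
countFin {suc n} f = (if f zero then 1 else 0) + countFin (λ i → f (suc i))

reach : ∀ {n} → Digraph n → ℕ → Fin n → Fin n → Bool
reach A zero x z = ⌊ x ≟ z ⌋
reach A (suc k) x z = reach A k x z ∨ anyFin (λ w → reach A k x w ∧ A w z)

-- atDist A x i z ≡ true  iff  ∂(x,z) = i  (the directed distance:
-- length of a shortest directed walk from x to z)
atDist : ∀ {n} → Digraph n → Fin n → ℕ → Fin n → Bool
atDist A x zero z = reach A zero x z
atDist A x (suc i) z = reach A (suc i) x z ∧ not (reach A i x z)

StronglyConnected : ∀ {n} → Digraph n → Set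
StronglyConnected {n} A = (x z : Fin n) → ∃[ k ] reach A k x z ≡ true

Diameter : ∀ {n} → Digraph n → ℕ → Set
Diameter {n} A D =
  ((x z : Fin n) → reach A D x z ≡ true) ×
  (∃[ x ] ∃[ z ] atDist A x D z ≡ true)

outCount : ∀ {n} → Digraph n → Fin n → Fin n → ℕ → ℕ
outCount A x y j = countFin (λ z → A y z ∧ atDist A x j z)

inCount : ∀ {n} → Digraph n → Fin n → Fin n → ℕ → ℕ
inCount A x y j = countFin (λ z → A z y ∧ atDist A x j z)

DistanceRegular : ∀ {n} → Digraph n → ℕ → Set
DistanceRegular {n} A D =
  Σ (ℕ → ℕ → ℕ) λ dout → Σ (ℕ → ℕ → ℕ) λ din →
    (i j : ℕ) → i ≤ D → j ≤ D → (x y : Fin n) → atDist A x i y ≡ true →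
      (outCount A x y j ≡ dout i j) × (inCount A x y j ≡ din i j)

OutRegular : ∀ {n} → Digraph n → ℕ → Set
OutRegular {n} A D =
  Σ (ℕ → ℕ → ℕ) λ b →
    (i j : ℕ) → i ≤ D → j ≤ D → (x y : Fin n) → atDist A x i y ≡ true →
      outCount A x y j ≡ b i j

{-# OPTIONS --safe #-}
module Submission where

-- Let w_m(u,v) be the number of walks of length m from u to v. Given the numbers
-- b_ij, the first-step recursion w_{m+1}(y,x) = Σ_z A(y,z) w_m(z,x) shows by
-- induction on m that w_m(y,x) depends only on i = ∂(x,y) (it is returnWalks m i).
-- Since ∂(y,x) is the least m with w_m(y,x) > 0, also ∂(y,x), and hence w_m(x,y),
-- depends only on ∂(x,y); call the latter h_m(∂(x,y)) (walksAt). Splitting the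
-- last step of a walk by the distance of its penultimate vertex from x gives
--   w_{j+1}(x,y) = Σ_{l ≤ j} |Γ←_1(y) ∩ Γ→_l(x)| h_j(l),
-- in which only l ≤ j occur and h_j(j) > 0, so the in-counts are determined
-- by ∂(x,y) one j at a time.

open import Defs
open import Data.Nat using (ℕ; zero; suc; _+_; _*_; _≤_; _<_; _≤′_; ≤′-refl; ≤′-step; z≤n; s≤s; s≤s⁻¹; >-nonZero)
open import Data.Nat.Properties
  using (+-*-semiring; +-identityʳ; *-identityˡ; *-identityʳ; *-zeroʳ; *-assoc; *-comm; *-cancelʳ-≡;
         +-cancelˡ-≡; m≤m+n; n≤1+n; ≤-refl; ≤-trans; ≤-reflexive; ≤⇒≤′; m≤n⇒m<n∨m≡n; <-cmp; >⇒≢;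
         module ≤-Reasoning)
open import Data.Nat.Induction using (<-rec)
open import Data.Fin using (Fin; zero; suc; toℕ; fromℕ; fromℕ<; inject₁)
open import Data.Fin.Properties
  using (_≟_; any?; toℕ-fromℕ<; toℕ-inject₁; toℕ-fromℕ; toℕ<n; toℕ-injective; punchInᵢ≢i)
open import Data.Vec.Functional using (removeAt)
open import Data.Bool using (Bool; true; false; _∧_; _∨_; not; if_then_else_)
import Data.Bool as Bool
open import Data.Bool.Properties using (∧-conicalˡ; ∧-conicalʳ; ∨-conicalʳ; ∧-zeroʳ; ∨-zeroʳ; ¬-not; not-¬)
open import Data.Product using (_×_; _,_; proj₁; proj₂; ∃₂; ∃-syntax)
open import Data.Sum using (inj₁; inj₂)
open import Relation.Nullary using (¬_; yes; no; contradiction)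
open import Relation.Nullary.Decidable using (Dec; ⌊_⌋; isYes≗does; dec-true; dec-false)
open import Relation.Binary.PropositionalEquality
  using (_≡_; _≢_; refl; sym; trans; cong; cong₂; subst; module ≡-Reasoning)
open import Function using (_∘_)
open import Relation.Binary.Definitions using (tri<; tri≈; tri>)
open import Algebra.Properties.Semiring.Sum +-*-semiring

⟦_⟧ : Bool → ℕ
⟦ b ⟧ = if b then 1 else 0

⌊⌋-true : ∀ {P : Set} (P? : Dec P) → P → ⌊ P? ⌋ ≡ true
⌊⌋-true P? p = trans (isYes≗does P?) (dec-true P? p)

⌊⌋-false : ∀ {P : Set} (P? : Dec P) → ¬ P → ⌊ P? ⌋ ≡ false
⌊⌋-false P? ¬p = trans (isYes≗does P?) (dec-false P? ¬p)

⟦∧⟧ : ∀ a b → ⟦ a ∧ b ⟧ ≡ ⟦ a ⟧ * ⟦ b ⟧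
⟦∧⟧ true  true  = refl
⟦∧⟧ true  false = refl
⟦∧⟧ false b     = refl

countFin≡∑ : ∀ {n} (p : Fin n → Bool) → countFin p ≡ ∑[ z < n ] ⟦ p z ⟧
countFin≡∑ {zero}  p = refl
countFin≡∑ {suc n} p = cong (⟦ p zero ⟧ +_) (countFin≡∑ (λ i → p (suc i)))

∑-zero : ∀ {n} (f : Fin n → ℕ) → (∀ z → f z ≡ 0) → ∑[ z < n ] f z ≡ 0
∑-zero {n} f f≡0 = trans (sum-cong-≗ f≡0) (sum-replicate-zero n)

∑-select : ∀ {n} (f : Fin n → ℕ) u → (∀ z → z ≢ u → f z ≡ 0) → ∑[ z < n ] f z ≡ f u
∑-select {suc n} f u f≡0 = begin
  sum f                     ≡⟨ sum-remove f ⟩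
  f u + sum (removeAt f u)  ≡⟨ cong (f u +_) (∑-zero _ (λ z → f≡0 _ (punchInᵢ≢i u z))) ⟩
  f u + 0                   ≡⟨ +-identityʳ (f u) ⟩
  f u                       ∎
  where open ≡-Reasoning

∑-δˡ : ∀ {n} u (f : Fin n → ℕ) → ∑[ w < n ] (⟦ ⌊ u ≟ w ⌋ ⟧ * f w) ≡ f u
∑-δˡ u f = begin
  ∑[ w < _ ] (⟦ ⌊ u ≟ w ⌋ ⟧ * f w)  ≡⟨ ∑-select _ u off-u ⟩
  ⟦ ⌊ u ≟ u ⌋ ⟧ * f u               ≡⟨ cong (λ b → ⟦ b ⟧ * f u) (⌊⌋-true (u ≟ u) refl) ⟩
  1 * f u                           ≡⟨ *-identityˡ (f u) ⟩
  f u                               ∎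
  where
  open ≡-Reasoning
  off-u : ∀ w → w ≢ u → ⟦ ⌊ u ≟ w ⌋ ⟧ * f w ≡ 0
  off-u w w≢u = cong (λ b → ⟦ b ⟧ * f w) (⌊⌋-false (u ≟ w) (w≢u ∘ sym))

∑-δʳ : ∀ {n} v (f : Fin n → ℕ) → ∑[ w < n ] (f w * ⟦ ⌊ w ≟ v ⌋ ⟧) ≡ f v
∑-δʳ v f = begin
  ∑[ w < _ ] (f w * ⟦ ⌊ w ≟ v ⌋ ⟧)  ≡⟨ ∑-select _ v off-v ⟩
  f v * ⟦ ⌊ v ≟ v ⌋ ⟧               ≡⟨ cong (λ b → f v * ⟦ b ⟧) (⌊⌋-true (v ≟ v) refl) ⟩
  f v * 1                           ≡⟨ *-identityʳ (f v) ⟩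
  f v                               ∎
  where
  open ≡-Reasoning
  off-v : ∀ w → w ≢ v → f w * ⟦ ⌊ w ≟ v ⌋ ⟧ ≡ 0
  off-v w w≢v = trans (cong (λ b → f w * ⟦ b ⟧) (⌊⌋-false (w ≟ v) w≢v)) (*-zeroʳ (f w))

term≤∑ : ∀ {n} (f : Fin n → ℕ) u → f u ≤ ∑[ w < n ] f w
term≤∑ {suc n} f u = ≤-trans (m≤m+n (f u) _) (≤-reflexive (sym (sum-remove f)))

∑≤-init-last : ∀ m (f : ℕ → ℕ) → ∑[ l ≤ m ] f (toℕ l) ≡ ∑[ l < m ] f (toℕ l) + f m
∑≤-init-last m f = begin
  ∑[ l ≤ m ] f (toℕ l)                                ≡⟨ sum-init-last {m} (f ∘ toℕ) ⟩
  ∑[ l < m ] f (toℕ (inject₁ l)) + f (toℕ (fromℕ m))  ≡⟨ cong₂ _+_ (sum-cong-≗ {m} (cong f ∘ toℕ-inject₁))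
                                                                  (cong f (toℕ-fromℕ m)) ⟩
  ∑[ l < m ] f (toℕ l) + f m                          ∎
  where open ≡-Reasoning

∑≤-select : ∀ K (g : ℕ → ℕ) l → l ≤ K → (∀ j → j ≢ l → g j ≡ 0) → ∑[ j ≤ K ] g (toℕ j) ≡ g l
∑≤-select K g l l≤K g≡0 = trans (∑-select _ l̂ off-l) (cong g (toℕ-fromℕ< (s≤s l≤K)))
  where
  l̂ : Fin (suc K)
  l̂ = fromℕ< (s≤s l≤K)
  off-l : ∀ j → j ≢ l̂ → g (toℕ j) ≡ 0
  off-l j j≢l̂ = g≡0 (toℕ j) (λ j≡l → j≢l̂ (toℕ-injective (trans j≡l (sym (toℕ-fromℕ< (s≤s l≤K))))))

anyFin⁺ : ∀ {n} (f : Fin n → Bool) z → f z ≡ true → anyFin f ≡ true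
anyFin⁺ {suc n} f zero    fz≡true rewrite fz≡true = refl
anyFin⁺ {suc n} f (suc z) fz≡true = trans (cong (f zero ∨_) (anyFin⁺ (f ∘ suc) z fz≡true)) (∨-zeroʳ (f zero))

anyFin⁻ : ∀ {n} (f : Fin n → Bool) → anyFin f ≡ true → ∃[ z ] f z ≡ true
anyFin⁻ {suc n} f any≡true with f zero in f0
... | true  = zero , f0
... | false = let z , fz = anyFin⁻ (f ∘ suc) any≡true in suc z , fz

anyFin-false : ∀ {n} (f : Fin n → Bool) → anyFin f ≡ false → ∀ z → f z ≡ false
anyFin-false f any≡false z with f z in fz
... | false = refl
... | true with () ← trans (sym any≡false) (anyFin⁺ f z fz)

invariant⇒constant : ∀ {X Y : Set} {R : X → Y → Set} → Dec (∃₂ R) → (f : X → Y → ℕ) →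
                     (∀ {x y u v} → R x y → R u v → f x y ≡ f u v) →
                     ∃[ c ] (∀ {x y} → R x y → f x y ≡ c)
invariant⇒constant (yes (u , v , Ruv)) f invariant = f u v , λ Rxy → invariant Rxy Ruv
invariant⇒constant (no ∄R)             f _         = 0 , λ Rxy → contradiction (_ , _ , Rxy) ∄R

module Walks {n : ℕ} (A : Digraph n) where

  reach-mono : ∀ {k k′} x z → k ≤ k′ → reach A k x z ≡ true → reach A k′ x z ≡ true
  reach-mono x z = go ∘ ≤⇒≤′
    where
    go : ∀ {k k′} → k ≤′ k′ → reach A k x z ≡ true → reach A k′ x z ≡ true
    go ≤′-refl         r = r
    go (≤′-step k≤′k′) r rewrite go k≤′k′ r = refl

  atDist⇒reach : ∀ x l z → atDist A x l z ≡ true → reach A l x z ≡ true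
  atDist⇒reach x zero    z d = d
  atDist⇒reach x (suc l) z d = ∧-conicalˡ _ _ d

  atDist⇒¬reach-pred : ∀ x s z → atDist A x (suc s) z ≡ true → reach A s x z ≡ false
  atDist⇒¬reach-pred x s z d with reach A s x z
  ... | false = refl
  ... | true  with () ← d

  atDist⇒¬reach : ∀ x s z {m} → atDist A x s z ≡ true → m < s → reach A m x z ≡ false
  atDist⇒¬reach x (suc s) z {m} d m<s with reach A m x z in r
  ... | false = refl
  ... | true  with () ← trans (sym (reach-mono x z (s≤s⁻¹ m<s) r)) (atDist⇒¬reach-pred x s z d)

  atDist-unique : ∀ x z l l′ → atDist A x l z ≡ true → atDist A x l′ z ≡ true → l ≡ l′
  atDist-unique x z l l′ d d′ with <-cmp l l′
  ... | tri≈ _ l≡l′ _ = l≡l′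
  ... | tri< l<l′ _ _ with () ← trans (sym (atDist⇒reach x l z d)) (atDist⇒¬reach x l′ z d′ l<l′)
  ... | tri> _ _ l′<l with () ← trans (sym (atDist⇒reach x l′ z d′)) (atDist⇒¬reach x l z d l′<l)

  atDist-false : ∀ x z l l′ → atDist A x l z ≡ true → l′ ≢ l → atDist A x l′ z ≡ false
  atDist-false x z l l′ d l′≢l with atDist A x l′ z in d′
  ... | false = refl
  ... | true  = contradiction (atDist-unique x z l′ l d′ d) l′≢l

  reach⇒atDist : ∀ k x z → reach A k x z ≡ true → ∃[ l ] l ≤ k × atDist A x l z ≡ true
  reach⇒atDist zero    x z r = zero , ≤-refl , r
  reach⇒atDist (suc k) x z r with reach A k x z Bool.≟ true
  ... | yes r′ = let l , l≤k , d = reach⇒atDist k x z r′ in l , ≤-trans l≤k (n≤1+n k) , d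
  ... | no ¬r′ = suc k , ≤-refl , cong₂ _∧_ r (cong not (¬-not ¬r′))

  pairAtDist? : ∀ l → Dec (∃₂ λ x z → atDist A x l z ≡ true)
  pairAtDist? l = any? λ x → any? λ z → atDist A x l z Bool.≟ true

  walks : ℕ → Fin n → Fin n → ℕ
  walks zero    u v = ⟦ ⌊ u ≟ v ⌋ ⟧
  walks (suc m) u v = ∑[ w < n ] (walks m u w * ⟦ A w v ⟧)

  walks-suc-first : ∀ m u v → walks (suc m) u v ≡ ∑[ z < n ] (⟦ A u z ⟧ * walks m z v)
  walks-suc-first zero    u v = trans (∑-δˡ u (λ w → ⟦ A w v ⟧)) (sym (∑-δʳ v (λ z → ⟦ A u z ⟧)))
  walks-suc-first (suc m) u v = begin
      ∑[ w < n ] (walks (suc m) u w * ⟦ A w v ⟧)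
    ≡⟨ sum-cong-≗ (λ w → cong (_* ⟦ A w v ⟧) (walks-suc-first m u w)) ⟩
      ∑[ w < n ] (∑[ z < n ] (⟦ A u z ⟧ * walks m z w) * ⟦ A w v ⟧)
    ≡⟨ sum-cong-≗ (λ w → *-distribʳ-sum ⟦ A w v ⟧ (λ z → ⟦ A u z ⟧ * walks m z w)) ⟩
      ∑[ w < n ] ∑[ z < n ] (⟦ A u z ⟧ * walks m z w * ⟦ A w v ⟧)
    ≡⟨ ∑-comm (λ w z → ⟦ A u z ⟧ * walks m z w * ⟦ A w v ⟧) ⟩
      ∑[ z < n ] ∑[ w < n ] (⟦ A u z ⟧ * walks m z w * ⟦ A w v ⟧)
    ≡⟨ sum-cong-≗ (λ z → trans (sum-cong-≗ (λ w → *-assoc ⟦ A u z ⟧ (walks m z w) ⟦ A w v ⟧))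
                               (sym (*-distribˡ-sum ⟦ A u z ⟧ (λ w → walks m z w * ⟦ A w v ⟧)))) ⟩
      ∑[ z < n ] (⟦ A u z ⟧ * walks (suc m) z v)
    ∎
    where open ≡-Reasoning

  ¬reach⇒walks≡0 : ∀ m u v → reach A m u v ≡ false → walks m u v ≡ 0
  ¬reach⇒walks≡0 zero    u v r = cong ⟦_⟧ r
  ¬reach⇒walks≡0 (suc m) u v r = ∑-zero _ term≡0
    where
    term≡0 : ∀ w → walks m u w * ⟦ A w v ⟧ ≡ 0
    term≡0 w with reach A m u w in r′ | anyFin-false (λ w′ → reach A m u w′ ∧ A w′ v) (∨-conicalʳ _ _ r) w
    ... | false | _            = cong (_* ⟦ A w v ⟧) (¬reach⇒walks≡0 m u w r′)
    ... | true  | A[w,v]≡false = trans (cong (λ b → walks m u w * ⟦ b ⟧) A[w,v]≡false) (*-zeroʳ (walks m u w))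

  walks-extend : ∀ m u w v → 0 < walks m u w → A w v ≡ true → 0 < walks (suc m) u v
  walks-extend m u w v walks>0 A[w,v] = begin-strict
    0                          <⟨ walks>0 ⟩
    walks m u w                ≡⟨ *-identityʳ _ ⟨
    walks m u w * ⟦ true ⟧     ≡⟨ cong (λ b → walks m u w * ⟦ b ⟧) A[w,v] ⟨
    walks m u w * ⟦ A w v ⟧    ≤⟨ term≤∑ (λ w′ → walks m u w′ * ⟦ A w′ v ⟧) w ⟩
    walks (suc m) u v          ∎
    where open ≤-Reasoning

  reach⇒walks>0 : ∀ k u v → reach A k u v ≡ true → ∃[ m ] m ≤ k × 0 < walks m u v
  reach⇒walks>0 zero    u v r = zero , ≤-refl , subst (λ b → 0 < ⟦ b ⟧) (sym r) (s≤s z≤n)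
  reach⇒walks>0 (suc k) u v r with reach A k u v Bool.≟ true
  ... | yes r′ = let m , m≤k , walks>0 = reach⇒walks>0 k u v r′ in m , ≤-trans m≤k (n≤1+n k) , walks>0
  ... | no ¬r′ =
    let step = λ w → reach A k u w ∧ A w v
        w , r∧A = anyFin⁻ step (trans (cong (_∨ anyFin step) (sym (¬-not ¬r′))) r)
        m , m≤k , walks>0 = reach⇒walks>0 k u w (∧-conicalˡ _ _ r∧A)
    in suc m , s≤s m≤k , walks-extend m u w v walks>0 (∧-conicalʳ _ _ r∧A)

  atDist⇒walks≡0 : ∀ u s v {m} → atDist A u s v ≡ true → m < s → walks m u v ≡ 0
  atDist⇒walks≡0 u s v {m} d m<s = ¬reach⇒walks≡0 m u v (atDist⇒¬reach u s v d m<s)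

  atDist⇒walks>0 : ∀ u s v → atDist A u s v ≡ true → 0 < walks s u v
  atDist⇒walks>0 u s v d with reach⇒walks>0 s u v (atDist⇒reach u s v d)
  ... | m , m≤s , walks>0 with m≤n⇒m<n∨m≡n m≤s
  ...   | inj₂ refl = walks>0
  ...   | inj₁ m<s  = contradiction (atDist⇒walks≡0 u s v d m<s) (>⇒≢ walks>0)

  walks-determine-distance : ∀ u v u′ v′ s s′ → (∀ m → walks m u v ≡ walks m u′ v′) →
                             atDist A u s v ≡ true → atDist A u′ s′ v′ ≡ true → s ≡ s′
  walks-determine-distance u v u′ v′ s s′ same d d′ with <-cmp s s′
  ... | tri≈ _ s≡s′ _ = s≡s′
  ... | tri< s<s′ _ _ = contradiction (trans (same s) (atDist⇒walks≡0 u′ s′ v′ d′ s<s′))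
                                      (>⇒≢ (atDist⇒walks>0 u s v d))
  ... | tri> _ _ s′<s = contradiction (trans (sym (same s′)) (atDist⇒walks≡0 u s v d s′<s))
                                      (>⇒≢ (atDist⇒walks>0 u′ s′ v′ d′))

  distance-split : ∀ K x z (t : ℕ) (F : ℕ → ℕ) →
                   (∀ l → atDist A x l z ≡ true → t ≡ F l) → (reach A K x z ≡ false → t ≡ 0) →
                   t ≡ ∑[ l ≤ K ] (⟦ atDist A x (toℕ l) z ⟧ * F (toℕ l))
  distance-split K x z t F t≡F t≡0 with reach A K x z Bool.≟ true
  ... | no ¬r = trans (t≡0 (¬-not ¬r)) (sym (∑-zero _ (λ l → cong (λ b → ⟦ b ⟧ * F (toℕ l)) (beyond l))))
    where
    beyond : ∀ (l : Fin (suc K)) → atDist A x (toℕ l) z ≡ false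
    beyond l with atDist A x (toℕ l) z in d
    ... | false = refl
    ... | true  = contradiction (reach-mono x z (s≤s⁻¹ (toℕ<n l)) (atDist⇒reach x (toℕ l) z d)) ¬r
  ... | yes r with reach⇒atDist K x z r
  ... | l , l≤K , d = begin
    t                              ≡⟨ t≡F l d ⟩
    F l                            ≡⟨ *-identityˡ (F l) ⟨
    ⟦ true ⟧ * F l                 ≡⟨ cong (λ b → ⟦ b ⟧ * F l) d ⟨
    ⟦ atDist A x l z ⟧ * F l       ≡⟨ ∑≤-select K (λ j → ⟦ atDist A x j z ⟧ * F j) l l≤K off-l ⟨
    ∑[ j ≤ K ] (⟦ atDist A x (toℕ j) z ⟧ * F (toℕ j))  ∎
    where
    open ≡-Reasoning
    off-l : ∀ j → j ≢ l → ⟦ atDist A x j z ⟧ * F j ≡ 0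
    off-l j j≢l = cong (λ b → ⟦ b ⟧ * F j) (atDist-false x z l j d j≢l)

  ∑-by-distance : ∀ K x (a : Fin n → Bool) (t : Fin n → ℕ) (F : ℕ → ℕ) →
                  (∀ l z → atDist A x l z ≡ true → t z ≡ F l) → (∀ z → reach A K x z ≡ false → t z ≡ 0) →
                  ∑[ z < n ] (⟦ a z ⟧ * t z) ≡ ∑[ l ≤ K ] (countFin (λ z → a z ∧ atDist A x (toℕ l) z) * F (toℕ l))
  ∑-by-distance K x a t F t≡F t≡0 = begin
      ∑[ z < n ] (⟦ a z ⟧ * t z)
    ≡⟨ sum-cong-≗ (λ z → cong (⟦ a z ⟧ *_) (distance-split K x z (t z) F (λ l → t≡F l z) (t≡0 z))) ⟩
      ∑[ z < n ] (⟦ a z ⟧ * ∑[ l ≤ K ] (⟦ d l z ⟧ * F (toℕ l)))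
    ≡⟨ sum-cong-≗ (λ z → trans (*-distribˡ-sum ⟦ a z ⟧ (λ l → ⟦ d l z ⟧ * F (toℕ l)))
                               (sum-cong-≗ (merge z))) ⟩
      ∑[ z < n ] ∑[ l ≤ K ] (⟦ a z ∧ d l z ⟧ * F (toℕ l))
    ≡⟨ ∑-comm (λ z l → ⟦ a z ∧ d l z ⟧ * F (toℕ l)) ⟩
      ∑[ l ≤ K ] ∑[ z < n ] (⟦ a z ∧ d l z ⟧ * F (toℕ l))
    ≡⟨ sum-cong-≗ (λ l → trans (cong (_* F (toℕ l)) (countFin≡∑ (λ z → a z ∧ d l z)))
                               (*-distribʳ-sum (F (toℕ l)) (λ z → ⟦ a z ∧ d l z ⟧))) ⟨
      ∑[ l ≤ K ] (countFin (λ z → a z ∧ d l z) * F (toℕ l))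
    ∎
    where
    open ≡-Reasoning
    d : Fin (suc K) → Fin n → Bool
    d l z = atDist A x (toℕ l) z
    merge : ∀ z l → ⟦ a z ⟧ * (⟦ d l z ⟧ * F (toℕ l)) ≡ ⟦ a z ∧ d l z ⟧ * F (toℕ l)
    merge z l = trans (sym (*-assoc ⟦ a z ⟧ _ _)) (cong (_* F (toℕ l)) (sym (⟦∧⟧ (a z) (d l z))))

  inCount≡0 : ∀ j → ¬ ∃₂ (λ u v → atDist A u j v ≡ true) → ∀ x y → inCount A x y j ≡ 0
  inCount≡0 j ∄ x y = trans (countFin≡∑ (λ z → A z y ∧ atDist A x j z)) (∑-zero _ term≡0)
    where
    term≡0 : ∀ z → ⟦ A z y ∧ atDist A x j z ⟧ ≡ 0
    term≡0 z = cong ⟦_⟧ (trans (cong (A z y ∧_) (¬-not (λ d → ∄ (x , z , d)))) (∧-zeroʳ (A z y)))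

module FromOutRegular {n : ℕ} (A : Digraph n) (D : ℕ) (reach-D : ∀ x z → reach A D x z ≡ true)
                      (b : ℕ → ℕ → ℕ)
                      (b-out : ∀ i j → i ≤ D → j ≤ D → ∀ x y → atDist A x i y ≡ true → outCount A x y j ≡ b i j) where

  open Walks A

  distance : ∀ x z → ∃[ l ] l ≤ D × atDist A x l z ≡ true
  distance x z = reach⇒atDist D x z (reach-D x z)

  atDist⇒≤D : ∀ x l z → atDist A x l z ≡ true → l ≤ D
  atDist⇒≤D x l z d = let l′ , l′≤D , d′ = distance x z in subst (_≤ D) (atDist-unique x z l′ l d′ d) l′≤D

  returnWalks : ℕ → ℕ → ℕ
  returnWalks zero    zero    = 1
  returnWalks zero    (suc _) = 0
  returnWalks (suc m) i       = ∑[ l ≤ D ] (b i (toℕ l) * returnWalks m (toℕ l))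

  walks-back : ∀ m x i y → atDist A x i y ≡ true → walks m y x ≡ returnWalks m i
  walks-back zero x zero y d with x ≟ y
  ... | yes refl = cong ⟦_⟧ (⌊⌋-true (x ≟ x) refl)
  ... | no _     with () ← d
  walks-back zero x (suc i) y d = cong ⟦_⟧ (⌊⌋-false (y ≟ x) y≢x)
    where
    y≢x : y ≢ x
    y≢x refl with () ← atDist-unique x x 0 (suc i) (⌊⌋-true (x ≟ x) refl) d
  walks-back (suc m) x i y d = begin
      walks (suc m) y x
    ≡⟨ walks-suc-first m y x ⟩
      ∑[ z < n ] (⟦ A y z ⟧ * walks m z x)
    ≡⟨ ∑-by-distance D x (A y) (λ z → walks m z x) (returnWalks m)
                     (λ l z → walks-back m x l z) (λ z ¬r → contradiction ¬r (not-¬ (reach-D x z))) ⟩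
      ∑[ l ≤ D ] (outCount A x y (toℕ l) * returnWalks m (toℕ l))
    ≡⟨ sum-cong-≗ (λ l → cong (_* returnWalks m (toℕ l)) (b-out i (toℕ l) i≤D (s≤s⁻¹ (toℕ<n l)) x y d)) ⟩
      returnWalks (suc m) i
    ∎
    where
    open ≡-Reasoning
    i≤D : i ≤ D
    i≤D = atDist⇒≤D x i y d

  walks-invariant : ∀ j x y u v → atDist A x j y ≡ true → atDist A u j v ≡ true → ∀ m → walks m x y ≡ walks m u v
  walks-invariant j x y u v d d′ m with distance y x | distance v u
  ... | s , _ , e | s′ , _ , e′ = begin
    walks m x y       ≡⟨ walks-back m y s x e ⟩
    returnWalks m s   ≡⟨ cong (returnWalks m) s≡s′ ⟩
    returnWalks m s′  ≡⟨ walks-back m v s′ u e′ ⟨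
    walks m u v       ∎
    where
    open ≡-Reasoning
    s≡s′ : s ≡ s′
    s≡s′ = walks-determine-distance y x v u s s′ (λ m → trans (walks-back m x j y d) (sym (walks-back m u j v d′))) e e′

  walks-constant : ∀ m j → ∃[ c ] (∀ {x y} → atDist A x j y ≡ true → walks m x y ≡ c)
  walks-constant m j = invariant⇒constant (pairAtDist? j) (walks m)
                         (λ {x} {y} {u} {v} d d′ → walks-invariant j x y u v d d′ m)

  walksAt : ℕ → ℕ → ℕ
  walksAt m j = proj₁ (walks-constant m j)

  walksAt-diag>0 : ∀ j u v → atDist A u j v ≡ true → 0 < walksAt j j
  walksAt-diag>0 j u v d = subst (0 <_) (proj₂ (walks-constant j j) d) (atDist⇒walks>0 u j v d)

  walks-suc≡∑inCount : ∀ m x y → walks (suc m) x y ≡ ∑[ l ≤ m ] (inCount A x y (toℕ l) * walksAt m (toℕ l))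
  walks-suc≡∑inCount m x y = trans (sum-cong-≗ (λ z → *-comm (walks m x z) ⟦ A z y ⟧))
    (∑-by-distance m x (λ z → A z y) (walks m x) (walksAt m)
                   (λ l z → proj₂ (walks-constant m l)) (λ z → ¬reach⇒walks≡0 m x z))

  inCount-invariant : ∀ i x y x′ y′ → atDist A x i y ≡ true → atDist A x′ i y′ ≡ true →
                      ∀ j → inCount A x y j ≡ inCount A x′ y′ j
  inCount-invariant i x y x′ y′ d d′ = <-rec _ step
    where
    earlier : Fin n → Fin n → ℕ → ℕ
    earlier u v j = ∑[ l < j ] (inCount A u v (toℕ l) * walksAt j (toℕ l))

    cancel : ∀ j → Dec (∃₂ λ u v → atDist A u j v ≡ true) →
             inCount A x y j * walksAt j j ≡ inCount A x′ y′ j * walksAt j j → inCount A x y j ≡ inCount A x′ y′ j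
    cancel j (yes (u , v , e)) eq = *-cancelʳ-≡ _ _ (walksAt j j) {{>-nonZero (walksAt-diag>0 j u v e)}} eq
    cancel j (no ∄)            _  = trans (inCount≡0 j ∄ x y) (sym (inCount≡0 j ∄ x′ y′))

    step : ∀ j → (∀ {l} → l < j → inCount A x y l ≡ inCount A x′ y′ l) → inCount A x y j ≡ inCount A x′ y′ j
    step j below = cancel j (pairAtDist? j) (+-cancelˡ-≡ (earlier x y j) _ _ (begin
        earlier x y j + inCount A x y j * walksAt j j
      ≡⟨ ∑≤-init-last j (λ l → inCount A x y l * walksAt j l) ⟨
        ∑[ l ≤ j ] (inCount A x y (toℕ l) * walksAt j (toℕ l))
      ≡⟨ walks-suc≡∑inCount j x y ⟨
        walks (suc j) x y
      ≡⟨ walks-invariant i x y x′ y′ d d′ (suc j) ⟩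
        walks (suc j) x′ y′
      ≡⟨ walks-suc≡∑inCount j x′ y′ ⟩
        ∑[ l ≤ j ] (inCount A x′ y′ (toℕ l) * walksAt j (toℕ l))
      ≡⟨ ∑≤-init-last j (λ l → inCount A x′ y′ l * walksAt j l) ⟩
        earlier x′ y′ j + inCount A x′ y′ j * walksAt j j
      ≡⟨ cong (_+ _) (sum-cong-≗ (λ l → cong (_* walksAt j (toℕ l)) (below (toℕ<n l)))) ⟨
        earlier x y j + inCount A x′ y′ j * walksAt j j
      ∎))
      where open ≡-Reasoning

  inCount-constant : ∀ i j → ∃[ c ] (∀ {x y} → atDist A x i y ≡ true → inCount A x y j ≡ c)
  inCount-constant i j = invariant⇒constant (pairAtDist? i) (λ x y → inCount A x y j)
                           (λ {x} {y} {u} {v} d d′ → inCount-invariant i x y u v d d′ j)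

  distanceRegular : DistanceRegular A D
  distanceRegular = b , (λ i j → proj₁ (inCount-constant i j)) ,
                    λ i j i≤D j≤D x y d → b-out i j i≤D j≤D x y d , proj₂ (inCount-constant i j) d

distanceRegular⇒outRegular : ∀ {n} (A : Digraph n) D → DistanceRegular A D → OutRegular A D
distanceRegular⇒outRegular A D (dout , _ , d) = dout , λ i j i≤D j≤D x y e → proj₁ (d i j i≤D j≤D x y e)

theorem10p2 : ∀ {n} (A : Digraph n) (D : ℕ) → Simple A → StronglyConnected A → Diameter A D →
    (DistanceRegular A D → OutRegular A D) × (OutRegular A D → DistanceRegular A D)
theorem10p2 A D _ _ (reach-D , _) =
  distanceRegular⇒outRegular A D , λ (b , b-out) → FromOutRegular.distanceRegular A D reach-D b b-out
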